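{- For a point $p\in\operatorname{PG}(7,2)$, the eight lines $L^{ijk}(p)=\{p,A_{ijk}p,A_{ijk}^2p\}$, $i,j,k\in\{1,2\}$, are pairwise distinct if and only if $p\in\omega_4$.
   Context: Work over $\mathbb{F}_2$. $V_8=V(8,2)$ with basis $e_1,\dots,e_8$, $V_a=\langle e_1,e_8\rangle$, $V_b=\langle e_2,e_7\rangle$, $V_c=\langle e_3,e_6\rangle$, $V_d=\langle e_4,e_5\rangle$, $V_8=V_a\oplus V_b\oplus V_c\oplus V_d$; points of $\operatorname{PG}(7,2)$ are nonzero vectors. $\omega_4$ is the set of vectors all four of whose components in $V_a,V_b,V_c,V_d$ are nonzero. Let $\zeta_a\in\operatorname{GL}(V_a)$ be $e_1\mapsto e_8\mapsto e_1+e_8\mapsto e_1$, $\zeta_b: e_7\mapsto e_2\mapsto e_2+e_7\mapsto e_7$, $\zeta_c: e_3\mapsto e_6\mapsto e_3+e_6\mapsto e_3$, $\zeta_d: e_5\mapsto e_4\mapsto e_4+e_5\mapsto e_5$ (each of order 3). For $i,j,k\in\{1,2\}$ let $A_{ijk}=\zeta_a^i\oplus\zeta_b^j\oplus\zeta_c^k\oplus\zeta_d$; it satisfies $A_{ijk}^2+A_{ijk}+I=0$, so each $L^{ijk}(p)$ is a line of $\operatorname{PG}(7,2)$. -}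

module Defs where

open import Data.Bool using (Bool; true; false; _xor_; _∨_; _∧_)
open import Data.Fin using (Fin; zero; suc; toℕ)
open import Data.Nat using (ℕ)
open import Data.Vec using (Vec; []; _∷_; lookup; replicate; zipWith; foldr; map)
open import Data.Product using (_×_; _,_)
open import Data.Sum using (_⊎_)
open import Relation.Binary.PropositionalEquality using (_≡_; _≢_)
open import Relation.Nullary using (¬_)
open import Function using (_∘_; id)
open import Function.Bundles using (_⇔_)

-- V(8,2): vectors over F_2 = Bool (xor = addition, ∧ = multiplication),
-- coordinates w.r.t. the basis e₁,…,e₈ (index 0 ↔ e₁, …, index 7 ↔ e₈).
V8 : Set
V8 = Vec Bool 8

0v : V8
0v = replicate 8 false

_+v_ : V8 → V8 → V8
_+v_ = zipWith _xor_

_·v_ : Bool → V8 → V8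
b ·v v = map (b ∧_) v

e₁ e₂ e₃ e₄ e₅ e₆ e₇ e₈ : V8
e₁ = true  ∷ false ∷ false ∷ false ∷ false ∷ false ∷ false ∷ false ∷ []
e₂ = false ∷ true  ∷ false ∷ false ∷ false ∷ false ∷ false ∷ false ∷ []
e₃ = false ∷ false ∷ true  ∷ false ∷ false ∷ false ∷ false ∷ false ∷ []
e₄ = false ∷ false ∷ false ∷ true  ∷ false ∷ false ∷ false ∷ false ∷ []
e₅ = false ∷ false ∷ false ∷ false ∷ true  ∷ false ∷ false ∷ false ∷ []
e₆ = false ∷ false ∷ false ∷ false ∷ false ∷ true  ∷ false ∷ false ∷ []
e₇ = false ∷ false ∷ false ∷ false ∷ false ∷ false ∷ true  ∷ false ∷ []
e₈ = false ∷ false ∷ false ∷ false ∷ false ∷ false ∷ false ∷ true  ∷ []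

linExt : Vec V8 8 → V8 → V8
linExt imgs v = foldr _ _+v_ 0v (zipWith _·v_ v imgs)

-- ζ_a, ζ_b, ζ_c, ζ_d as endomorphisms of V8 acting on their own summand
-- and killing the other three summands (so that ζ_a^i ⊕ ζ_b^j ⊕ ζ_c^k ⊕ ζ_d
-- is their sum).
-- ζ_a : e₁ ↦ e₈ ↦ e₁+e₈
ζa : V8 → V8
ζa = linExt (e₈ ∷ 0v ∷ 0v ∷ 0v ∷ 0v ∷ 0v ∷ 0v ∷ (e₁ +v e₈) ∷ [])
ζb : V8 → V8
ζb = linExt (0v ∷ (e₂ +v e₇) ∷ 0v ∷ 0v ∷ 0v ∷ 0v ∷ e₂ ∷ 0v ∷ [])
ζc : V8 → V8
ζc = linExt (0v ∷ 0v ∷ e₆ ∷ 0v ∷ 0v ∷ (e₃ +v e₆) ∷ 0v ∷ 0v ∷ [])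
ζd : V8 → V8
ζd = linExt (0v ∷ 0v ∷ 0v ∷ (e₄ +v e₅) ∷ e₄ ∷ 0v ∷ 0v ∷ 0v ∷ [])

_^[_] : (V8 → V8) → ℕ → V8 → V8
f ^[ ℕ.zero ] = id
f ^[ ℕ.suc n ] = f ∘ (f ^[ n ])

exp : Fin 2 → ℕ
exp i = ℕ.suc (toℕ i)

A : Fin 2 → Fin 2 → Fin 2 → V8 → V8
A i j k v = (((ζa ^[ exp i ]) v +v (ζb ^[ exp j ]) v) +v (ζc ^[ exp k ]) v) +v ζd v

LineSet : (V8 → V8) → V8 → V8 → Set
LineSet M p x = x ≡ p ⊎ (x ≡ M p ⊎ x ≡ M (M p))

L : Fin 2 × Fin 2 × Fin 2 → V8 → V8 → Set
L (i , j , k) = LineSet (A i j k)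

SameSet : (V8 → Set) → (V8 → Set) → Set
SameSet X Y = ∀ x → X x ⇔ Y x

PairwiseDistinctLines : V8 → Set
PairwiseDistinctLines p =
  ∀ (t t′ : Fin 2 × Fin 2 × Fin 2) → t ≢ t′ → ¬ SameSet (L t p) (L t′ p)

IsPoint : V8 → Set
IsPoint p = p ≢ 0v

-- components in V_a = ⟨e₁,e₈⟩, V_b = ⟨e₂,e₇⟩, V_c = ⟨e₃,e₆⟩, V_d = ⟨e₄,e₅⟩ nonzero
compNonzero : Fin 8 → Fin 8 → V8 → Set
compNonzero m n v = (lookup v m ∨ lookup v n) ≡ true

ω₄ : V8 → Set
ω₄ v = compNonzero (Fin.zero) (suc (suc (suc (suc (suc (suc (suc Fin.zero))))))) v
     × compNonzero (suc Fin.zero) (suc (suc (suc (suc (suc (suc Fin.zero)))))) v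
     × compNonzero (suc (suc Fin.zero)) (suc (suc (suc (suc (suc Fin.zero))))) v
     × compNonzero (suc (suc (suc Fin.zero))) (suc (suc (suc (suc Fin.zero)))) v

-- In the coordinates (e₁,e₈), (e₂,e₇), (e₃,e₆), (e₄,e₅) of V_a, V_b, V_c, V_d the maps ζ_a
-- and ζ_c are the order-3 map ζ(x,y) = (y, x+y) of F₂², while ζ_b and ζ_d are ζ²; so A_{ijk}
-- acts on the four components as ζ^i, ζ^{2j}, ζ^k, ζ².  Two lines through p coincide iff
-- A_{t'}p ∈ {p, A_t p, A_t² p}.  A nonzero d-component rules out A_{t'}p = p and
-- A_{t'}p = A_t²p, since on it both maps act as ζ² while ζ has no nonzero fixed point; and
-- A_{t'}p = A_t p forces t = t' once the a-, b- and c-components are nonzero, since ζ and ζ²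
-- differ on nonzero vectors.  Conversely, a zero a-, b- or c-component makes the two lines
-- differing only in that exponent agree pointwise, and a zero d-component gives
-- L^{111}(p) = L^{222}(p).
module Submission where

open import Defs
open import Data.Bool using (Bool; true; false; _xor_; _∨_)
open import Data.Bool.Properties using (_≟_)
open import Data.Empty using (⊥-elim)
open import Data.Nat as ℕ using ()
open import Data.Fin using (Fin; zero; suc; opposite)
open import Data.Fin.Properties using (all?; opposite-involutive)
open import Data.Product using (_×_; _,_; proj₁; proj₂)
open import Data.Sum using (inj₁; inj₂; [_,_]′; swap; map; map₂)
open import Data.Vec using (Vec; []; _∷_)
open import Data.Vec.Properties using (≡-dec)
open import Function using (_∘_)
open import Function.Bundles using (_⇔_; mk⇔; Equivalence)
open import Relation.Binary.PropositionalEquality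
open import Relation.Nullary using (Dec)
open import Relation.Nullary.Decidable using (map′; _×-dec_; from-yes)
open import Relation.Unary using (Decidable)

all-Vec-Bool? : ∀ {n p} {P : Vec Bool n → Set p} → Decidable P → Dec (∀ v → P v)
all-Vec-Bool? {ℕ.zero} P? = map′ (λ { h [] → h }) (λ h → h []) (P? [])
all-Vec-Bool? {ℕ.suc n} P? =
  map′ (λ { (f , t) (false ∷ v) → f v ; (f , t) (true ∷ v) → t v })
       (λ h → (λ v → h (false ∷ v)) , (λ v → h (true ∷ v)))
       (all-Vec-Bool? (P? ∘ (false ∷_)) ×-dec all-Vec-Bool? (P? ∘ (true ∷_)))

F₂² : Set
F₂² = Bool × Bool

0₂ : F₂²
0₂ = false , false

Nonzero : F₂² → Set
Nonzero (x , y) = (x ∨ y) ≡ true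

nonzero-if-≢0₂ : ∀ x → x ≢ 0₂ → Nonzero x
nonzero-if-≢0₂ (false , false) x≢0 = ⊥-elim (x≢0 refl)
nonzero-if-≢0₂ (false , true) _ = refl
nonzero-if-≢0₂ (true , _) _ = refl

ζ : F₂² → F₂²
ζ (x , y) = y , x xor y

ζ-cube : ∀ x → ζ (ζ (ζ x)) ≡ x
ζ-cube (false , false) = refl
ζ-cube (false , true) = refl
ζ-cube (true , false) = refl
ζ-cube (true , true) = refl

ζ²-no-fixed-point : ∀ x → Nonzero x → ζ (ζ x) ≢ x
ζ²-no-fixed-point (false , false) ()
ζ²-no-fixed-point (false , true) _ ()
ζ²-no-fixed-point (true , false) _ ()
ζ²-no-fixed-point (true , true) _ ()

ζ≢ζ² : ∀ x → Nonzero x → ζ x ≢ ζ (ζ x)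
ζ≢ζ² (false , false) ()
ζ≢ζ² (false , true) _ ()
ζ≢ζ² (true , false) _ ()
ζ≢ζ² (true , true) _ ()

pattern one = zero
pattern two = suc zero

ζ^ : Fin 2 → F₂² → F₂²
ζ^ one = ζ
ζ^ two = ζ ∘ ζ

ζ^-exponent-injective : ∀ {e e′} x → Nonzero x → ζ^ e x ≡ ζ^ e′ x → e ≡ e′
ζ^-exponent-injective {one} {one} _ _ _ = refl
ζ^-exponent-injective {one} {two} x x≢0 eq = ⊥-elim (ζ≢ζ² x x≢0 eq)
ζ^-exponent-injective {two} {one} x x≢0 eq = ⊥-elim (ζ≢ζ² x x≢0 (sym eq))
ζ^-exponent-injective {two} {two} _ _ _ = refl

opposite-injective : ∀ {n} {i j : Fin n} → opposite i ≡ opposite j → i ≡ j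
opposite-injective {i = i} {j} eq =
  trans (sym (opposite-involutive i)) (trans (cong opposite eq) (opposite-involutive j))

Q : Set
Q = F₂² × F₂² × F₂² × F₂²

Index : Set
Index = Fin 2 × Fin 2 × Fin 2

⟦_⟧ : Q → V8
⟦ (a₁ , a₂) , (b₁ , b₂) , (c₁ , c₂) , (d₁ , d₂) ⟧ = a₁ ∷ b₁ ∷ c₁ ∷ d₁ ∷ d₂ ∷ c₂ ∷ b₂ ∷ a₂ ∷ []

components : V8 → Q
components (a₁ ∷ b₁ ∷ c₁ ∷ d₁ ∷ d₂ ∷ c₂ ∷ b₂ ∷ a₂ ∷ []) = (a₁ , a₂) , (b₁ , b₂) , (c₁ , c₂) , (d₁ , d₂)

⟦components⟧ : ∀ v → ⟦ components v ⟧ ≡ v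
⟦components⟧ (_ ∷ _ ∷ _ ∷ _ ∷ _ ∷ _ ∷ _ ∷ _ ∷ []) = refl

⟦⟧-injective : ∀ {q r} → ⟦ q ⟧ ≡ ⟦ r ⟧ → q ≡ r
⟦⟧-injective = cong components

-- ζ_b^j = ζ^{2j}, and 2j ≡ 3 − j (mod 3)
act : Index → Q → Q
act (i , j , k) (a , b , c , d) = ζ^ i a , ζ^ (opposite j) b , ζ^ k c , ζ (ζ d)

A[_] : Index → V8 → V8
A[ i , j , k ] = A i j k

A-in-components : ∀ i j k v → A i j k v ≡ ⟦ act (i , j , k) (components v) ⟧
A-in-components = from-yes (all? λ i → all? λ j → all? λ k → all-Vec-Bool? λ v →
  ≡-dec _≟_ (A i j k v) ⟦ act (i , j , k) (components v) ⟧)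

A-⟦⟧ : ∀ t q → A[ t ] ⟦ q ⟧ ≡ ⟦ act t q ⟧
A-⟦⟧ (i , j , k) q = A-in-components i j k ⟦ q ⟧

A²-⟦⟧ : ∀ t q → A[ t ] (A[ t ] ⟦ q ⟧) ≡ ⟦ act t (act t q) ⟧
A²-⟦⟧ t q = trans (cong A[ t ] (A-⟦⟧ t q)) (A-⟦⟧ t (act t q))

act-no-fixed-point : ∀ t {a b c d} → Nonzero d → act t (a , b , c , d) ≢ (a , b , c , d)
act-no-fixed-point t {d = d} d≢0 eq = ζ²-no-fixed-point d d≢0 (cong (proj₂ ∘ proj₂ ∘ proj₂) eq)

act-not-square : ∀ t t′ {a b c d} → Nonzero d →
  act t′ (a , b , c , d) ≢ act t (act t (a , b , c , d))
act-not-square t t′ {d = d} d≢0 eq =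
  ζ≢ζ² d d≢0 (sym (trans (cong (proj₂ ∘ proj₂ ∘ proj₂) eq) (ζ-cube (ζ d))))

act-index-injective : ∀ t t′ {a b c d} → Nonzero a → Nonzero b → Nonzero c →
  act t (a , b , c , d) ≡ act t′ (a , b , c , d) → t ≡ t′
act-index-injective (i , j , k) (i′ , j′ , k′) {a} {b} {c} a≢0 b≢0 c≢0 eq =
  cong₂ _,_ (ζ^-exponent-injective a a≢0 (cong proj₁ eq))
    (cong₂ _,_ (opposite-injective (ζ^-exponent-injective b b≢0 (cong (proj₁ ∘ proj₂) eq)))
               (ζ^-exponent-injective c c≢0 (cong (proj₁ ∘ proj₂ ∘ proj₂) eq)))

same-line-if-agree : ∀ {M N : V8 → V8} {p} → M p ≡ N p → M (M p) ≡ N (N p) →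
  SameSet (LineSet M p) (LineSet N p)
same-line-if-agree e e² _ = mk⇔ (map₂ (map (λ h → trans h e) (λ h → trans h e²)))
                                (map₂ (map (λ h → trans h (sym e)) (λ h → trans h (sym e²))))

same-line-if-swapped : ∀ {M N : V8 → V8} {p} → M p ≡ N (N p) → M (M p) ≡ N p →
  SameSet (LineSet M p) (LineSet N p)
same-line-if-swapped e e² _ = mk⇔ (map₂ (swap ∘ map (λ h → trans h e) (λ h → trans h e²)))
                                  (map₂ (map (λ h → trans h (sym e)) (λ h → trans h (sym e²)) ∘ swap))

module _ (t t′ : Index) (q : Q) where

  same-line-if-act-agrees : act t q ≡ act t′ q → act t (act t q) ≡ act t′ (act t′ q) →
    SameSet (L t ⟦ q ⟧) (L t′ ⟦ q ⟧)
  same-line-if-act-agrees e e² = same-line-if-agree {A[ t ]} {A[ t′ ]}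
    (trans (A-⟦⟧ t q) (trans (cong ⟦_⟧ e) (sym (A-⟦⟧ t′ q))))
    (trans (A²-⟦⟧ t q) (trans (cong ⟦_⟧ e²) (sym (A²-⟦⟧ t′ q))))

  same-line-if-act-swaps : act t q ≡ act t′ (act t′ q) → act t (act t q) ≡ act t′ q →
    SameSet (L t ⟦ q ⟧) (L t′ ⟦ q ⟧)
  same-line-if-act-swaps e e² = same-line-if-swapped {A[ t ]} {A[ t′ ]}
    (trans (A-⟦⟧ t q) (trans (cong ⟦_⟧ e) (sym (A²-⟦⟧ t′ q))))
    (trans (A²-⟦⟧ t q) (trans (cong ⟦_⟧ e²) (sym (A-⟦⟧ t′ q))))

lines-distinct : ∀ q → ω₄ ⟦ q ⟧ → PairwiseDistinctLines ⟦ q ⟧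
lines-distinct q@(a , b , c , d) (a≢0 , b≢0 , c≢0 , d≢0) t t′ t≢t′ same =
  [ act-no-fixed-point t′ {a} {b} {c} {d} d≢0 ∘ in-components refl
  , [ t≢t′ ∘ sym ∘ act-index-injective t′ t {d = d} a≢0 b≢0 c≢0 ∘ in-components (A-⟦⟧ t q)
    , act-not-square t t′ {a} {b} {c} {d} d≢0 ∘ in-components (A²-⟦⟧ t q) ]′ ]′
  (Equivalence.from (same (A[ t′ ] ⟦ q ⟧)) (inj₂ (inj₁ refl)))
  where
  in-components : ∀ {x r} → x ≡ ⟦ r ⟧ → A[ t′ ] ⟦ q ⟧ ≡ x → act t′ q ≡ r
  in-components x≡r eq = ⟦⟧-injective (trans (sym (A-⟦⟧ t′ q)) (trans eq x≡r))

lines-coincide-if-a-zero : ∀ j k b c d →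
  SameSet (L (one , j , k) ⟦ 0₂ , b , c , d ⟧) (L (two , j , k) ⟦ 0₂ , b , c , d ⟧)
lines-coincide-if-a-zero j k b c d =
  same-line-if-act-agrees (one , j , k) (two , j , k) (0₂ , b , c , d) refl refl

lines-coincide-if-b-zero : ∀ i k a c d →
  SameSet (L (i , one , k) ⟦ a , 0₂ , c , d ⟧) (L (i , two , k) ⟦ a , 0₂ , c , d ⟧)
lines-coincide-if-b-zero i k a c d =
  same-line-if-act-agrees (i , one , k) (i , two , k) (a , 0₂ , c , d) refl refl

lines-coincide-if-c-zero : ∀ i j a b d →
  SameSet (L (i , j , one) ⟦ a , b , 0₂ , d ⟧) (L (i , j , two) ⟦ a , b , 0₂ , d ⟧)
lines-coincide-if-c-zero i j a b d =
  same-line-if-act-agrees (i , j , one) (i , j , two) (a , b , 0₂ , d) refl refl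

lines-coincide-if-d-zero : ∀ a b c →
  SameSet (L (one , one , one) ⟦ a , b , c , 0₂ ⟧) (L (two , two , two) ⟦ a , b , c , 0₂ ⟧)
lines-coincide-if-d-zero a b c =
  same-line-if-act-swaps (one , one , one) (two , two , two) (a , b , c , 0₂)
    (cong₂ _,_ (sym (ζ-cube (ζ a))) (cong₂ _,_ refl (cong₂ _,_ (sym (ζ-cube (ζ c))) refl)))
    (cong₂ _,_ refl (cong₂ _,_ (ζ-cube (ζ b)) refl))

nonzero-if-lines-distinct : ∀ q → PairwiseDistinctLines ⟦ q ⟧ → ω₄ ⟦ q ⟧
nonzero-if-lines-distinct (a , b , c , d) distinct =
    nonzero-if-≢0₂ a (λ { refl → distinct (one , one , one) (two , one , one) (λ ())
                                   (lines-coincide-if-a-zero one one b c d) })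
  , nonzero-if-≢0₂ b (λ { refl → distinct (one , one , one) (one , two , one) (λ ())
                                   (lines-coincide-if-b-zero one one a c d) })
  , nonzero-if-≢0₂ c (λ { refl → distinct (one , one , one) (one , one , two) (λ ())
                                   (lines-coincide-if-c-zero one one a b d) })
  , nonzero-if-≢0₂ d (λ { refl → distinct (one , one , one) (two , two , two) (λ ())
                                   (lines-coincide-if-d-zero a b c) })

lemma1 : (p : V8) → IsPoint p → (PairwiseDistinctLines p ⇔ ω₄ p)
lemma1 p _ = subst (λ v → PairwiseDistinctLines v ⇔ ω₄ v) (⟦components⟧ p)
  (mk⇔ (nonzero-if-lines-distinct (components p)) (lines-distinct (components p)))
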